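{- For every $n\geq1$, $|Q_{4,4}(T,(4n+1)\times(4n+2))|=|Q_{1,2}(T,(4n+7)\times(4n+7))|$.
   Context: Let $\mathcal{A}=\{\mathtt{A},\dots,\mathtt{P}\}$. The substitution $\mu$ maps each letter to a $2\times2$ block over $\mathcal{A}$ (written (first row / second row)): $\mathtt{A}\mapsto(\mathtt{AF}/\mathtt{GC})$, $\mathtt{B}\mapsto(\mathtt{AF}/\mathtt{HD})$, $\mathtt{C}\mapsto(\mathtt{BE}/\mathtt{GC})$, $\mathtt{D}\mapsto(\mathtt{BE}/\mathtt{HD})$, $\mathtt{E}\mapsto(\mathtt{AN}/\mathtt{GK})$, $\mathtt{F}\mapsto(\mathtt{AN}/\mathtt{HL})$, $\mathtt{G}\mapsto(\mathtt{BM}/\mathtt{GK})$, $\mathtt{H}\mapsto(\mathtt{BM}/\mathtt{HL})$, $\mathtt{I}\mapsto(\mathtt{IF}/\mathtt{OC})$, $\mathtt{J}\mapsto(\mathtt{IF}/\mathtt{PD})$, $\mathtt{K}\mapsto(\mathtt{JE}/\mathtt{OC})$, $\mathtt{L}\mapsto(\mathtt{JE}/\mathtt{PD})$, $\mathtt{M}\mapsto(\mathtt{IN}/\mathtt{OK})$, $\mathtt{N}\mapsto(\mathtt{IN}/\mathtt{PL})$, $\mathtt{O}\mapsto(\mathtt{JM}/\mathtt{OK})$, $\mathtt{P}\mapsto(\mathtt{JM}/\mathtt{PL})$. For a matrix $X$ over $\mathcal{A}$, $\mu(X)$ replaces each entry by its $2\times2$ block; $\mu^0=\mathrm{id}$,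 $\mu^k=\mu^{k-1}\circ\mu$; $T_k:=\mu^k(\mathtt{N})$. For a matrix $X$, $X[r,c,m\times n]$ is its $m\times n$ contiguous submatrix with upper-left corner at row $r$, column $c$; $P(X,m\times n)$ is the set of all its $m\times n$ contiguous submatrices; $P(T,m\times n):=\bigcup_{k\ge0}P(T_k,m\times n)$. For $i,j\in\{1,2,3,4\}$, $Q_{i,j}(T,m\times n):=\{\mu^2(x)[i,j,m\times n]: x\in P(T,m\times n)\}$. -}

module Defs where

open import Data.Nat using (ℕ; zero; suc; _+_; _∸_)
open import Data.Fin using (Fin; toℕ)
open import Data.Vec using (Vec; []; _∷_; lookup)
open import Data.List using (List; length)
open import Data.List.Membership.Propositional using (_∈_)
open import Data.List.Relation.Unary.Unique.Propositional using (Unique)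
open import Data.Maybe using (Maybe; just; nothing)
open import Data.Product using (Σ; _×_; _,_; ∃)
open import Function.Bundles using (_⇔_)
open import Relation.Binary.PropositionalEquality using (_≡_)

data Letter : Set where
  A B C D E F G H I J K L M N O P : Letter

Mat : ℕ → ℕ → Set
Mat m n = Vec (Vec Letter n) m

-- 2x2 image blocks: (first row / second row) = ((a b) / (c d))
top bot : Letter → Letter × Letter
top A = A , F
top B = A , F
top C = B , E
top D = B , E
top E = A , N
top F = A , N
top G = B , M
top H = B , M
top I = I , F
top J = I , F
top K = J , E
top L = J , E
top M = I , N
top N = I , N
top O = J , M
top P = J , M
bot A = G , C
bot B = H , D
bot C = G , C
bot D = H , D
bot E = G , K
bot F = H , L
bot G = G , K
bot H = H , L
bot I = O , C
bot J = P , D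
bot K = O , C
bot L = P , D
bot M = O , K
bot N = P , L
bot O = O , K
bot P = P , L

double : ℕ → ℕ
double zero = zero
double (suc n) = suc (suc (double n))

rowImg : (Letter → Letter × Letter) → ∀ {n} → Vec Letter n → Vec Letter (double n)
rowImg f [] = []
rowImg f (x ∷ v) with f x
... | a , b = a ∷ b ∷ rowImg f v

μ : ∀ {m n} → Mat m n → Mat (double m) (double n)
μ [] = []
μ (r ∷ rs) = rowImg top r ∷ rowImg bot r ∷ μ rs

iterN : ℕ → (ℕ → ℕ) → ℕ → ℕ
iterN zero f x = x
iterN (suc k) f x = iterN k f (f x)

μ^ : (k : ℕ) → ∀ {m n} → Mat m n → Mat (iterN k double m) (iterN k double n)
μ^ zero X = X
μ^ (suc k) X = μ^ k (μ X)

T : (k : ℕ) → Mat (iterN k double 1) (iterN k double 1)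
T k = μ^ k ((N ∷ []) ∷ [])

vat : ∀ {n} → Vec Letter n → ℕ → Maybe Letter
vat [] _ = nothing
vat (x ∷ v) zero = just x
vat (x ∷ v) (suc c) = vat v c

at : ∀ {M N} → Mat M N → ℕ → ℕ → Maybe Letter
at [] _ _ = nothing
at (row ∷ X) zero c = vat row c
at (row ∷ X) (suc r) c = at X r c

-- x = X[r+1, c+1, m×n]  (r, c are 0-based offsets of the upper-left corner)
OccursAt : ∀ {m n M N'} → Mat m n → Mat M N' → ℕ → ℕ → Set
OccursAt {m} {n} x X r c =
  (i : Fin m) (j : Fin n) → at X (r + toℕ i) (c + toℕ j) ≡ just (lookup (lookup x i) j)

InP : ∀ {m n M N'} → Mat M N' → Mat m n → Set
InP X x = Σ ℕ λ r → Σ ℕ λ c → OccursAt x X r c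

InPT : ∀ {m n} → Mat m n → Set
InPT x = Σ ℕ λ k → InP (T k) x

-- y ∈ Q_{i,j}(T, m×n)  (i, j are 1-based as in the paper)
InQ : (i j m n : ℕ) → Mat m n → Set
InQ i j m n y = Σ (Mat m n) λ x → InPT x × OccursAt y (μ^ 2 x) (i ∸ 1) (j ∸ 1)

HasCard : ∀ {X : Set} → (X → Set) → ℕ → Set
HasCard {X} S c = Σ (List X) λ l → Unique l × (∀ x → (x ∈ l) ⇔ S x) × length l ≡ c

-- Every finite pattern of T is a window of the fixed point U : ℕ → ℕ → Letter of μ grown
-- from the letter I (μ(I) has I in its corner), so Q_{i,j}(T, m×n) consists of the m×n windows
-- of U at positions (4R + i − 1, 4Q + j − 1).  Cutting a (4n+7)-square window at (4R, 4Q + 1)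
-- down to its (4n+1)×(4n+2) subwindow at offset (3, 2) thus maps Q_{1,2} onto Q_{4,4}, and this
-- map is injective because U is locally recognizable: for each of the 76 distinct 2×2 windows g
-- of U, the 4×5 block of μ²(g) starting in row 3 or 0 and column 3 or 0 determines the 7×7 block
-- of μ²(g) at (0, 1).  The big window is tiled by such 7×7 blocks, and the matching 4×5 blocks
-- all lie in the small window.  Both sets are finite since every 2×2 window of U occurs at a
-- position below 24, hence, by halving, every window of size at most k + 2 occurs below 24·2ᵏ.
module Submission where

open import Defs
open import Data.Fin.Base as Fin using (Fin; toℕ; fromℕ<)
open import Data.Fin.Properties using (toℕ<n; toℕ-fromℕ<)
open import Data.List.Base using (List; []; _∷_; map; length; deduplicate; upTo; cartesianProduct)
open import Data.List.Properties using (length-map)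
open import Data.List.Membership.Propositional using (_∈_)
open import Data.List.Membership.Propositional.Properties
  using (∈-map⁻; map-∈↔; deduplicate-∈⇔; ∈-upTo⁺; ∈-cartesianProduct⁺)
import Data.List.Membership.DecPropositional as DecMembership
open import Data.List.Relation.Unary.All as All using (All; all?)
import Data.List.Relation.Unary.All.Properties as All
open import Data.List.Relation.Unary.Any using (here; there)
open import Data.List.Relation.Unary.Unique.Propositional using (Unique; []; _∷_)
open import Data.List.Relation.Unary.Unique.DecPropositional.Properties using (deduplicate-!)
open import Data.Maybe.Base using (just; fromMaybe) renaming (map to mapMaybe)
open import Data.Maybe.Properties using (just-injective)
open import Data.Nat.Base
  using (ℕ; zero; suc; _+_; _*_; _∸_; _≤_; _<_; _≤′_; ≤′-refl; ≤′-step; z≤n; s≤s; z<s; s<s;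
         NonZero; >-nonZero⁻¹; ⌊_/2⌋; parity)
open import Data.Nat.Properties
open import Data.Nat.Tactic.RingSolver using (solve-∀)
open import Data.Parity.Base using (Parity; 0ℙ; 1ℙ)
open import Data.Product.Base using (Σ; ∃; ∃₂; _×_; _,_; proj₁; proj₂; map₁; uncurry)
open import Data.Vec.Base using (Vec; []; _∷_; lookup; tabulate)
open import Data.Vec.Properties using (lookup∘tabulate; tabulate∘lookup; tabulate-cong; ≡-dec)
open import Function.Base using (_∘_)
open import Function.Bundles using (_⇔_; mk⇔; Equivalence)
import Function.Properties.Equivalence as ⇔
open import Function.Properties.Inverse using (↔⇒⇔)
open import Relation.Binary.Definitions using (DecidableEquality)
open import Relation.Binary.PropositionalEquality
  using (_≡_; refl; sym; trans; cong; cong₂; subst; subst₂; module ≡-Reasoning)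
open import Relation.Nullary.Decidable using (Dec; yes; no; map′; toWitness; _×-dec_; _→-dec_)
open import Relation.Nullary.Negation using (contradiction)

open Equivalence using (to; from)

index : Letter → ℕ
index A = 0
index B = 1
index C = 2
index D = 3
index E = 4
index F = 5
index G = 6
index H = 7
index I = 8
index J = 9
index K = 10
index L = 11
index M = 12
index N = 13
index O = 14
index P = 15

letter : ℕ → Letter
letter 0  = A
letter 1  = B
letter 2  = C
letter 3  = D
letter 4  = E
letter 5  = F
letter 6  = G
letter 7  = H
letter 8  = I
letter 9  = J
letter 10 = K
letter 11 = L
letter 12 = M
letter 13 = N
letter 14 = O
letter _  = P

letter-index : ∀ x → letter (index x) ≡ x
letter-index A = refl
letter-index B = refl
letter-index C = refl
letter-index D = refl
letter-index E = refl
letter-index F = refl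
letter-index G = refl
letter-index H = refl
letter-index I = refl
letter-index J = refl
letter-index K = refl
letter-index L = refl
letter-index M = refl
letter-index N = refl
letter-index O = refl
letter-index P = refl

index-injective : ∀ {x y} → index x ≡ index y → x ≡ y
index-injective {x} {y} eq = trans (sym (letter-index x)) (trans (cong letter eq) (letter-index y))

_≟ᴸ_ : DecidableEquality Letter
x ≟ᴸ y = map′ index-injective (cong index) (index x ≟ index y)

_≟ᴹ_ : ∀ {m n} → DecidableEquality (Mat m n)
_≟ᴹ_ = ≡-dec (≡-dec _≟ᴸ_)

lookup-tabulate² : ∀ {m n} (f : Fin m → Fin n → Letter) i j →
  lookup (lookup (tabulate λ i → tabulate (f i)) i) j ≡ f i j
lookup-tabulate² f i j =
  trans (cong (λ row → lookup row j) (lookup∘tabulate _ i)) (lookup∘tabulate (f i) j)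

Mat-ext : ∀ {m n} {X Y : Mat m n} → (∀ i j → lookup (lookup X i) j ≡ lookup (lookup Y i) j) → X ≡ Y
Mat-ext {X = X} {Y} eq =
  trans (sym (tabulate∘lookup X)) (trans (tabulate-cong (Vec-ext ∘ eq)) (tabulate∘lookup Y))
  where
  Vec-ext : ∀ {n} {u v : Vec Letter n} → (∀ j → lookup u j ≡ lookup v j) → u ≡ v
  Vec-ext {u = u} {v} eq =
    trans (sym (tabulate∘lookup u)) (trans (tabulate-cong eq) (tabulate∘lookup v))

vat-lookup : ∀ {n} (v : Vec Letter n) j → vat v (toℕ j) ≡ just (lookup v j)
vat-lookup (x ∷ v) Fin.zero    = refl
vat-lookup (x ∷ v) (Fin.suc j) = vat-lookup v j

at-lookup : ∀ {m n} (X : Mat m n) i j → at X (toℕ i) (toℕ j) ≡ just (lookup (lookup X i) j)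
at-lookup (row ∷ X) Fin.zero    j = vat-lookup row j
at-lookup (row ∷ X) (Fin.suc i) j = at-lookup X i j

vat-just⇒< : ∀ {n} (v : Vec Letter n) q {z} → vat v q ≡ just z → q < n
vat-just⇒< (x ∷ v) zero    _  = z<s
vat-just⇒< (x ∷ v) (suc q) eq = s<s (vat-just⇒< v q eq)

at-just⇒< : ∀ {m n} (X : Mat m n) p q {z} → at X p q ≡ just z → p < m × q < n
at-just⇒< (row ∷ X) zero    q eq = z<s , vat-just⇒< row q eq
at-just⇒< (row ∷ X) (suc p) q eq = map₁ s<s (at-just⇒< X p q eq)

parity-double+ : ∀ R p → parity (double R + p) ≡ parity p
parity-double+ zero    p = refl
parity-double+ (suc R) p = parity-double+ R p

⌊double+/2⌋ : ∀ R p → ⌊ double R + p /2⌋ ≡ R + ⌊ p /2⌋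
⌊double+/2⌋ zero    p = refl
⌊double+/2⌋ (suc R) p = cong suc (⌊double+/2⌋ R p)

double-⌊/2⌋-+-rem : ∀ r → Σ ℕ λ a → a < 2 × double ⌊ r /2⌋ + a ≡ r
double-⌊/2⌋-+-rem zero          = 0 , z<s , refl
double-⌊/2⌋-+-rem (suc zero)    = 1 , s<s z<s , refl
double-⌊/2⌋-+-rem (suc (suc r)) with double-⌊/2⌋-+-rem r
... | a , a<2 , eq = a , a<2 , cong (suc ∘ suc) eq

⌊/2⌋-≤-pred : ∀ {r k} → r ≤ suc k → ⌊ r /2⌋ ≤ k
⌊/2⌋-≤-pred {k = k} r≤1+k = ≤-trans (⌊n/2⌋-mono r≤1+k) (≤-pred (⌊n/2⌋<n k))

⌊/2⌋-< : ∀ {p m} → p < double m → ⌊ p /2⌋ < m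
⌊/2⌋-< {zero}        {suc m} _                = z<s
⌊/2⌋-< {suc zero}    {suc m} _                = z<s
⌊/2⌋-< {suc (suc p)} {suc m} (s<s (s<s p<2m)) = s<s (⌊/2⌋-< p<2m)

double+<double : ∀ {a R bound} → a < 2 → R < bound → double R + a < double bound
double+<double {R = zero}  {suc bound} a<2 _             = ≤-trans a<2 (s≤s (s≤s z≤n))
double+<double {R = suc R} {suc bound} a<2 (s<s R<bound) = s<s (s<s (double+<double a<2 R<bound))

+-≤-double-suc-⌊/2⌋ : ∀ {a} m → a < 2 → a + m ≤ double (suc ⌊ m /2⌋)
+-≤-double-suc-⌊/2⌋ {a} zero          a<2 = subst (_≤ 2) (sym (+-identityʳ a)) (<⇒≤ a<2)
+-≤-double-suc-⌊/2⌋ {a} (suc zero)    a<2 = subst (_≤ 2) (+-comm 1 a) a<2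
+-≤-double-suc-⌊/2⌋ {a} (suc (suc m)) a<2 = begin
  a + suc (suc m)                 ≡⟨ +-suc a (suc m) ⟩
  suc (a + suc m)                 ≡⟨ cong suc (+-suc a m) ⟩
  suc (suc (a + m))               ≤⟨ s≤s (s≤s (+-≤-double-suc-⌊/2⌋ m a<2)) ⟩
  double (suc ⌊ suc (suc m) /2⌋)  ∎
  where open ≤-Reasoning

double≡2* : ∀ x → double x ≡ 2 * x
double≡2* zero    = refl
double≡2* (suc x) = trans (cong (suc ∘ suc) (double≡2* x)) (sym (*-suc 2 x))

double-double≡4* : ∀ x → double (double x) ≡ 4 * x
double-double≡4* x = begin
  double (double x)  ≡⟨ double≡2* (double x) ⟩
  2 * double x       ≡⟨ cong (2 *_) (double≡2* x) ⟩
  2 * (2 * x)        ≡⟨ *-assoc 2 2 x ⟨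
  4 * x              ∎
  where open ≡-Reasoning

n≤double : ∀ x → x ≤ double x
n≤double x = subst (x ≤_) (sym (double≡2* x)) (m≤m+n x (x + 0))

+≤iterN-double : ∀ k {x} → 0 < x → k + x ≤ iterN k double x
+≤iterN-double zero            _ = ≤-refl
+≤iterN-double (suc k) {suc x} _ = begin
  suc k + suc x                    ≡⟨ +-suc k (suc x) ⟨
  k + suc (suc x)                  ≤⟨ +-monoʳ-≤ k (s≤s (s≤s (n≤double x))) ⟩
  k + double (suc x)               ≤⟨ +≤iterN-double k z<s ⟩
  iterN k double (double (suc x))  ∎
  where open ≤-Reasoning

iterN-double-0 : ∀ k → iterN k double 0 ≡ 0
iterN-double-0 zero    = refl
iterN-double-0 (suc k) = iterN-double-0 k

-- The fixed point of μ

pick : Parity → Letter × Letter → Letter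
pick 0ℙ = proj₁
pick 1ℙ = proj₂

block : Parity → Parity → Letter → Letter
block 0ℙ b x = pick b (top x)
block 1ℙ b x = pick b (bot x)

vat-rowImg : ∀ f {n} (v : Vec Letter n) q →
  vat (rowImg f v) q ≡ mapMaybe (pick (parity q) ∘ f) (vat v ⌊ q /2⌋)
vat-rowImg f []      q             = refl
vat-rowImg f (x ∷ v) zero          = refl
vat-rowImg f (x ∷ v) (suc zero)    = refl
vat-rowImg f (x ∷ v) (suc (suc q)) = vat-rowImg f v q

at-μ : ∀ {m n} (X : Mat m n) p q →
  at (μ X) p q ≡ mapMaybe (block (parity p) (parity q)) (at X ⌊ p /2⌋ ⌊ q /2⌋)
at-μ []      p             q = refl
at-μ (r ∷ X) zero          q = vat-rowImg top r q
at-μ (r ∷ X) (suc zero)    q = vat-rowImg bot r q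
at-μ (r ∷ X) (suc (suc p)) q = at-μ X p q

-- U[ k ] r c is the entry (r, c) of μᵏ(I), read off the binary digits of r and c.  As μ(I) has
-- I in its top left corner these entries stabilise once r, c ≤ k, and U is the limit.
U[_] : ℕ → ℕ → ℕ → Letter
U[ zero  ] r c = I
U[ suc k ] r c = block (parity r) (parity c) (U[ k ] ⌊ r /2⌋ ⌊ c /2⌋)

U[]-step : ∀ {k r c} → r ≤ k → c ≤ k → U[ suc k ] r c ≡ U[ k ] r c
U[]-step {zero}          z≤n   z≤n   = refl
U[]-step {suc k} {r} {c} r≤1+k c≤1+k =
  cong (block (parity r) (parity c)) (U[]-step (⌊/2⌋-≤-pred r≤1+k) (⌊/2⌋-≤-pred c≤1+k))

U[]-stable : ∀ {k k′ r c} → r ≤ k → c ≤ k → k ≤′ k′ → U[ k′ ] r c ≡ U[ k ] r c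
U[]-stable r≤k c≤k ≤′-refl        = refl
U[]-stable r≤k c≤k (≤′-step k≤k′) = trans
  (U[]-step (≤-trans r≤k (≤′⇒≤ k≤k′)) (≤-trans c≤k (≤′⇒≤ k≤k′)))
  (U[]-stable r≤k c≤k k≤k′)

U : ℕ → ℕ → Letter
U r c = U[ r + c ] r c

U≡U[] : ∀ {k r c} → r ≤ k → c ≤ k → U r c ≡ U[ k ] r c
U≡U[] {k} {r} {c} r≤k c≤k = trans
  (sym (U[]-stable (m≤m+n r c) (m≤n+m c r) (≤⇒≤′ (m≤m+n (r + c) k))))
  (U[]-stable r≤k c≤k (≤⇒≤′ (m≤n+m k (r + c))))

U-unfold : ∀ p q → U p q ≡ block (parity p) (parity q) (U ⌊ p /2⌋ ⌊ q /2⌋)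
U-unfold p q = trans
  (U≡U[] (≤-trans (m≤m+n p q) (n≤1+n _)) (≤-trans (m≤n+m q p) (n≤1+n _)))
  (cong (block (parity p) (parity q))
        (sym (U≡U[] (≤-trans (⌊n/2⌋≤n p) (m≤m+n p q)) (≤-trans (⌊n/2⌋≤n q) (m≤n+m q p)))))

U-double+ : ∀ R Q p q →
  U (double R + p) (double Q + q) ≡ block (parity p) (parity q) (U (R + ⌊ p /2⌋) (Q + ⌊ q /2⌋))
U-double+ R Q p q = begin
  U (double R + p) (double Q + q)
    ≡⟨ U-unfold (double R + p) (double Q + q) ⟩
  block (parity (double R + p)) (parity (double Q + q)) parent
    ≡⟨ cong₂ (λ a b → block a b parent) (parity-double+ R p) (parity-double+ Q q) ⟩
  block (parity p) (parity q) parent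
    ≡⟨ cong (block (parity p) (parity q)) (cong₂ U (⌊double+/2⌋ R p) (⌊double+/2⌋ Q q)) ⟩
  block (parity p) (parity q) (U (R + ⌊ p /2⌋) (Q + ⌊ q /2⌋))
    ∎
  where
  open ≡-Reasoning
  parent : Letter
  parent = U ⌊ double R + p /2⌋ ⌊ double Q + q /2⌋

window : ∀ {m n} → ℕ → ℕ → Mat m n
window R Q = tabulate λ i → tabulate λ j → U (R + toℕ i) (Q + toℕ j)

window-unique : ∀ {m n} {X : Mat m n} R Q →
  (∀ i j → lookup (lookup X i) j ≡ U (R + toℕ i) (Q + toℕ j)) → X ≡ window R Q
window-unique R Q eq = Mat-ext λ i j → trans (eq i j) (sym (lookup-tabulate² _ i j))

at-window : ∀ {m n} R Q {p q} → p < m → q < n → at (window {m} {n} R Q) p q ≡ just (U (R + p) (Q + q))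
at-window {m} {n} R Q {p} {q} p<m q<n = begin
  at W p q                          ≡⟨ cong₂ (at W) (toℕ-fromℕ< p<m) (toℕ-fromℕ< q<n) ⟨
  at W (toℕ i) (toℕ j)              ≡⟨ at-lookup W i j ⟩
  just (lookup (lookup W i) j)      ≡⟨ cong just (lookup-tabulate² _ i j) ⟩
  just (U (R + toℕ i) (Q + toℕ j))  ≡⟨ cong₂ (λ p q → just (U (R + p) (Q + q)))
                                             (toℕ-fromℕ< p<m) (toℕ-fromℕ< q<n) ⟩
  just (U (R + p) (Q + q))          ∎
  where
  open ≡-Reasoning
  W : Mat m n
  W = window R Q
  i : Fin m
  i = fromℕ< p<m
  j : Fin n
  j = fromℕ< q<n

at-window-just : ∀ {m n} R Q {p q z} → at (window {m} {n} R Q) p q ≡ just z → z ≡ U (R + p) (Q + q)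
at-window-just {m} {n} R Q {p} {q} eq with at-just⇒< (window {m} {n} R Q) p q eq
... | p<m , q<n = just-injective (trans (sym eq) (at-window R Q p<m q<n))

window-μ : ∀ {m n} R Q → μ (window {m} {n} R Q) ≡ window (double R) (double Q)
window-μ {m} {n} R Q = window-unique (double R) (double Q) λ i j →
  just-injective (entry (toℕ i) (toℕ j) (toℕ<n i) (toℕ<n j) (at-lookup (μ W) i j))
  where
  W : Mat m n
  W = window R Q
  entry : ∀ p q {z} → p < double m → q < double n → at (μ W) p q ≡ just z →
    just z ≡ just (U (double R + p) (double Q + q))
  entry p q p<2m q<2n eq = begin
    just _
      ≡⟨ eq ⟨
    at (μ W) p q
      ≡⟨ at-μ W p q ⟩
    mapMaybe (block (parity p) (parity q)) (at W ⌊ p /2⌋ ⌊ q /2⌋)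
      ≡⟨ cong (mapMaybe _) (at-window R Q (⌊/2⌋-< p<2m) (⌊/2⌋-< q<2n)) ⟩
    just (block (parity p) (parity q) (U (R + ⌊ p /2⌋) (Q + ⌊ q /2⌋)))
      ≡⟨ cong just (U-double+ R Q p q) ⟨
    just (U (double R + p) (double Q + q))
      ∎
    where open ≡-Reasoning

window-μ^ : ∀ k {m n} R Q → μ^ k (window {m} {n} R Q) ≡ window (iterN k double R) (iterN k double Q)
window-μ^ zero    R Q = refl
window-μ^ (suc k) R Q = trans (cong (μ^ k) (window-μ R Q)) (window-μ^ k (double R) (double Q))

-- Entries outside X are read as the junk letter A; submatrix is only applied within range.
submatrix : ∀ {m n m′ n′} → ℕ → ℕ → Mat m′ n′ → Mat m n
submatrix r c X = tabulate λ i → tabulate λ j → fromMaybe A (at X (r + toℕ i) (c + toℕ j))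

offset< : ∀ {r i m m′} → i < m → r + m ≤ m′ → r + i < m′
offset< {r} i<m r+m≤m′ = <-≤-trans (+-monoʳ-< r i<m) r+m≤m′

submatrix-window : ∀ {m n m′ n′} R Q {r c} → r + m ≤ m′ → c + n ≤ n′ →
  submatrix r c (window {m′} {n′} R Q) ≡ window {m} {n} (R + r) (Q + c)
submatrix-window {m} {n} {m′} {n′} R Q {r} {c} r+m≤m′ c+n≤n′ =
  window-unique (R + r) (Q + c) λ i j → begin
  lookup (lookup (submatrix {m} {n} r c W) i) j
    ≡⟨ lookup-tabulate² _ i j ⟩
  fromMaybe A (at W (r + toℕ i) (c + toℕ j))
    ≡⟨ cong (fromMaybe A) (at-window R Q (offset< (toℕ<n i) r+m≤m′) (offset< (toℕ<n j) c+n≤n′)) ⟩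
  U (R + (r + toℕ i)) (Q + (c + toℕ j))
    ≡⟨ cong₂ U (+-assoc R r (toℕ i)) (+-assoc Q c (toℕ j)) ⟨
  U (R + r + toℕ i) (Q + c + toℕ j)
    ∎
  where
  open ≡-Reasoning
  W : Mat m′ n′
  W = window R Q

submatrix-μ-window : ∀ {m n m′ n′} R Q {a b} → a + m ≤ double m′ → b + n ≤ double n′ →
  submatrix a b (μ (window {m′} {n′} R Q)) ≡ window {m} {n} (double R + a) (double Q + b)
submatrix-μ-window {m} {n} {m′} {n′} R Q {a} {b} a-fits b-fits = trans
  (cong (submatrix {m} {n} a b) (window-μ {m′} {n′} R Q))
  (submatrix-window (double R) (double Q) a-fits b-fits)

μ²-window : ∀ {m n} R Q → μ (μ (window {m} {n} R Q)) ≡ window (4 * R) (4 * Q)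
μ²-window R Q = trans (window-μ^ 2 R Q) (cong₂ window (double-double≡4* R) (double-double≡4* Q))

submatrix-μ²-window : ∀ {m n m′ n′} R Q {a b} → a + m ≤ 4 * m′ → b + n ≤ 4 * n′ →
  submatrix a b (μ (μ (window {m′} {n′} R Q))) ≡ window {m} {n} (4 * R + a) (4 * Q + b)
submatrix-μ²-window {m} {n} {m′} {n′} R Q {a} {b} a-fits b-fits = trans
  (cong (submatrix {m} {n} a b) (μ²-window {m′} {n′} R Q))
  (submatrix-window (4 * R) (4 * Q)
    (subst (a + m ≤_) (sym (double-double≡4* m′)) a-fits)
    (subst (b + n ≤_) (sym (double-double≡4* n′)) b-fits))

OccursAt-window : ∀ {m n m′ n′} {x : Mat m n} R Q {r c} →
  OccursAt x (window {m′} {n′} R Q) r c → x ≡ window (R + r) (Q + c)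
OccursAt-window {m′ = m′} {n′} R Q {r} {c} occ = window-unique (R + r) (Q + c) λ i j → trans
  (at-window-just {m′} {n′} R Q (occ i j))
  (cong₂ U (sym (+-assoc R r (toℕ i))) (sym (+-assoc Q c (toℕ j))))

window-OccursAt : ∀ {m n m′ n′} R Q {r c} → r + m ≤ m′ → c + n ≤ n′ →
  OccursAt (window {m} {n} (R + r) (Q + c)) (window {m′} {n′} R Q) r c
window-OccursAt {m} {n} {m′} {n′} R Q {r} {c} r+m≤m′ c+n≤n′ i j = begin
  at W (r + toℕ i) (c + toℕ j)
    ≡⟨ at-window R Q (offset< (toℕ<n i) r+m≤m′) (offset< (toℕ<n j) c+n≤n′) ⟩
  just (U (R + (r + toℕ i)) (Q + (c + toℕ j)))
    ≡⟨ cong just (cong₂ U (+-assoc R r (toℕ i)) (+-assoc Q c (toℕ j))) ⟨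
  just (U (R + r + toℕ i) (Q + c + toℕ j))
    ≡⟨ cong just (lookup-tabulate² _ i j) ⟨
  just (lookup (lookup (window {m} {n} (R + r) (Q + c)) i) j)
    ∎
  where
  open ≡-Reasoning
  W : Mat m′ n′
  W = window R Q

window-≡⇒U≡ : ∀ {m n} R Q R′ Q′ {p q} → window {m} {n} R Q ≡ window R′ Q′ → p < m → q < n →
  U (R + p) (Q + q) ≡ U (R′ + p) (Q′ + q)
window-≡⇒U≡ {m} {n} R Q R′ Q′ {p} {q} eq p<m q<n = just-injective (begin
  just (U (R + p) (Q + q))          ≡⟨ at-window R Q p<m q<n ⟨
  at (window {m} {n} R Q) p q       ≡⟨ cong (λ X → at X p q) eq ⟩
  at (window {m} {n} R′ Q′) p q     ≡⟨ at-window R′ Q′ p<m q<n ⟩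
  just (U (R′ + p) (Q′ + q))   ∎)
  where open ≡-Reasoning

U≡⇒window-≡ : ∀ {m n} R Q R′ Q′ →
  (∀ p q → p < m → q < n → U (R + p) (Q + q) ≡ U (R′ + p) (Q′ + q)) → window {m} {n} R Q ≡ window R′ Q′
U≡⇒window-≡ R Q R′ Q′ agree = window-unique R′ Q′ λ i j →
  trans (lookup-tabulate² _ i j) (agree (toℕ i) (toℕ j) (toℕ<n i) (toℕ<n j))

window-≡-prefix : ∀ {m n m′ n′} R Q R′ Q′ → m ≤ m′ → n ≤ n′ →
  window {m′} {n′} R Q ≡ window R′ Q′ → window {m} {n} R Q ≡ window R′ Q′
window-≡-prefix R Q R′ Q′ m≤m′ n≤n′ eq = U≡⇒window-≡ R Q R′ Q′ λ p q p<m q<n →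
  window-≡⇒U≡ R Q R′ Q′ eq (<-≤-trans p<m m≤m′) (<-≤-trans q<n n≤n′)

window-≡-sub : ∀ {m n m′ n′} R Q R′ Q′ r c → r + m ≤ m′ → c + n ≤ n′ →
  window {m′} {n′} R Q ≡ window R′ Q′ → window {m} {n} (R + r) (Q + c) ≡ window (R′ + r) (Q′ + c)
window-≡-sub {m} {n} {m′} {n′} R Q R′ Q′ r c r+m≤m′ c+n≤n′ eq = begin
  window (R + r) (Q + c)                  ≡⟨ submatrix-window R Q r+m≤m′ c+n≤n′ ⟨
  submatrix r c (window {m′} {n′} R Q)    ≡⟨ cong (submatrix r c) eq ⟩
  submatrix r c (window {m′} {n′} R′ Q′)  ≡⟨ submatrix-window R′ Q′ r+m≤m′ c+n≤n′ ⟩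
  window (R′ + r) (Q′ + c)                ∎
  where open ≡-Reasoning

window-≡-μ : ∀ {m n m′ n′} R Q R′ Q′ a b → a + m ≤ double m′ → b + n ≤ double n′ →
  window {m′} {n′} R Q ≡ window R′ Q′ →
  window {m} {n} (double R + a) (double Q + b) ≡ window (double R′ + a) (double Q′ + b)
window-≡-μ {m} {n} {m′} {n′} R Q R′ Q′ a b a-fits b-fits eq = begin
  window (double R + a) (double Q + b)        ≡⟨ submatrix-μ-window R Q a-fits b-fits ⟨
  submatrix a b (μ (window {m′} {n′} R Q))    ≡⟨ cong (submatrix a b ∘ μ) eq ⟩
  submatrix a b (μ (window {m′} {n′} R′ Q′))  ≡⟨ submatrix-μ-window R′ Q′ a-fits b-fits ⟩
  window (double R′ + a) (double Q′ + b)      ∎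
  where open ≡-Reasoning

window-≡-μ² : ∀ {m n m′ n′} R Q R′ Q′ a b → a + m ≤ 4 * m′ → b + n ≤ 4 * n′ →
  window {m′} {n′} R Q ≡ window R′ Q′ →
  window {m} {n} (4 * R + a) (4 * Q + b) ≡ window (4 * R′ + a) (4 * Q′ + b)
window-≡-μ² {m} {n} {m′} {n′} R Q R′ Q′ a b a-fits b-fits eq = begin
  window (4 * R + a) (4 * Q + b)
    ≡⟨ submatrix-μ²-window {m} {n} {m′} {n′} R Q a-fits b-fits ⟨
  submatrix a b (μ (μ (window {m′} {n′} R Q)))
    ≡⟨ cong (submatrix a b ∘ μ ∘ μ) eq ⟩
  submatrix a b (μ (μ (window {m′} {n′} R′ Q′)))
    ≡⟨ submatrix-μ²-window {m} {n} {m′} {n′} R′ Q′ a-fits b-fits ⟩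
  window (4 * R′ + a) (4 * Q′ + b)
    ∎
  where open ≡-Reasoning

-- N = U 0 3.
T-window : ∀ k → T k ≡ window (iterN k double 0) (iterN k double 3)
T-window k = window-μ^ k 0 3

InPT⇒window : ∀ {m n} {x : Mat m n} → InPT x → ∃₂ λ R Q → x ≡ window R Q
InPT⇒window {x = x} (k , r , c , occ) =
  iterN k double 0 + r , iterN k double 3 + c ,
  OccursAt-window {m′ = iterN k double 1} {iterN k double 1} (iterN k double 0) (iterN k double 3)
    (subst (λ X → OccursAt x X r c) (T-window k) occ)

-- Since U 0 6 = I = U 0 0, the top left corner μᵏ(I) of U is also the top left corner of
-- T (k + 1), which is the window of U at column 6·2ᵏ.
window-InPT : ∀ {m n} R Q → InPT (window {m} {n} R Q)
window-InPT {m} {n} R Q =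
  suc k , R , Q ,
  subst₂ (λ x X → OccursAt x X R Q) (sym shifted) (sym (T-window (suc k)))
    (window-OccursAt z Z (fits 2 R-fits) (fits 2 Q-fits))
  where
  k z Z : ℕ
  k = R + m + (Q + n)
  z = iterN k double 0
  Z = iterN k double 6
  R-fits : R + m ≤ k
  R-fits = m≤m+n (R + m) (Q + n)
  Q-fits : Q + n ≤ k
  Q-fits = m≤n+m (Q + n) (R + m)
  fits : ∀ {a} x → {{NonZero x}} → a ≤ k → a ≤ iterN k double x
  fits x a≤k = ≤-trans a≤k (≤-trans (m≤m+n k x) (+≤iterN-double k (>-nonZero⁻¹ x)))
  corner : window {iterN k double 1} {iterN k double 1} z Z ≡ window z z
  corner = trans (sym (window-μ^ k 0 6)) (window-μ^ k 0 0)
  shifted : window {m} {n} R Q ≡ window (z + R) (Z + Q)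
  shifted = begin
    window R Q              ≡⟨ cong₂ (λ a b → window (a + R) (b + Q)) (iterN-double-0 k) (iterN-double-0 k) ⟨
    window (z + R) (z + Q)  ≡⟨ window-≡-sub z z z Z R Q (fits 1 R-fits) (fits 1 Q-fits) (sym corner) ⟩
    window (z + R) (Z + Q)  ∎
    where open ≡-Reasoning

InQ⇒window : ∀ i j {m n} (y : Mat m n) → InQ i j m n y →
  ∃₂ λ R Q → y ≡ window (4 * R + (i ∸ 1)) (4 * Q + (j ∸ 1))
InQ⇒window i j {m} {n} y (x , x∈T , occ) with InPT⇒window {x = x} x∈T
... | R , Q , refl =
  R , Q , OccursAt-window {m′ = double (double m)} {double (double n)} (4 * R) (4 * Q)
            (subst (λ X → OccursAt y X (i ∸ 1) (j ∸ 1)) (μ²-window {m} {n} R Q) occ)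

window-InQ : ∀ i j {m n} R Q → i ∸ 1 + m ≤ 4 * m → j ∸ 1 + n ≤ 4 * n →
  InQ i j m n (window (4 * R + (i ∸ 1)) (4 * Q + (j ∸ 1)))
window-InQ i j {m} {n} R Q i-fits j-fits =
  window R Q , window-InPT R Q ,
  subst (λ X → OccursAt (window {m} {n} (4 * R + (i ∸ 1)) (4 * Q + (j ∸ 1))) X (i ∸ 1) (j ∸ 1))
    (sym (μ²-window {m} {n} R Q))
    (window-OccursAt (4 * R) (4 * Q)
      (subst (i ∸ 1 + m ≤_) (sym (double-double≡4* m)) i-fits)
      (subst (j ∸ 1 + n ≤_) (sym (double-double≡4* n)) j-fits))

open DecMembership (_≟ᴹ_ {2} {2}) using (_∈?_)

-- One position for each 2×2 window of U; quads-closed shows that there are no others.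
quadPositions : List (ℕ × ℕ)
quadPositions =
  (0 , 0) ∷ (0 , 1) ∷ (1 , 0) ∷ (0 , 2) ∷ (1 , 1) ∷ (2 , 0) ∷ (0 , 3) ∷ (1 , 2) ∷ (2 , 1) ∷ (3 , 0) ∷
  (0 , 4) ∷ (1 , 3) ∷ (2 , 2) ∷ (3 , 1) ∷ (4 , 0) ∷ (0 , 5) ∷ (1 , 4) ∷ (2 , 3) ∷ (3 , 2) ∷ (4 , 1) ∷
  (5 , 0) ∷ (0 , 6) ∷ (1 , 5) ∷ (2 , 4) ∷ (3 , 3) ∷ (4 , 2) ∷ (5 , 1) ∷ (1 , 6) ∷ (2 , 5) ∷ (3 , 4) ∷
  (4 , 3) ∷ (5 , 2) ∷ (6 , 1) ∷ (2 , 6) ∷ (3 , 5) ∷ (4 , 4) ∷ (5 , 3) ∷ (6 , 2) ∷ (7 , 1) ∷ (2 , 7) ∷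
  (3 , 6) ∷ (4 , 5) ∷ (5 , 4) ∷ (6 , 3) ∷ (7 , 2) ∷ (2 , 8) ∷ (3 , 7) ∷ (4 , 6) ∷ (5 , 5) ∷ (7 , 3) ∷
  (10 , 0) ∷ (0 , 11) ∷ (3 , 8) ∷ (5 , 6) ∷ (7 , 4) ∷ (10 , 1) ∷ (11 , 0) ∷ (1 , 11) ∷ (10 , 2) ∷ (11 , 1) ∷
  (2 , 11) ∷ (10 , 3) ∷ (11 , 2) ∷ (3 , 11) ∷ (11 , 3) ∷ (4 , 11) ∷ (5 , 11) ∷ (6 , 11) ∷ (14 , 3) ∷ (7 , 11) ∷
  (15 , 3) ∷ (7 , 12) ∷ (15 , 4) ∷ (22 , 3) ∷ (23 , 3) ∷ (23 , 4) ∷ []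

quadPositions-< : All (λ (r , c) → r < 24 × c < 24) quadPositions
quadPositions-< = toWitness {a? = all? (λ (r , c) → r <? 24 ×-dec c <? 24) quadPositions} _

quads : List (Mat 2 2)
quads = map (uncurry window) quadPositions

children : Mat 2 2 → List (Mat 2 2)
children g = submatrix 0 0 (μ g) ∷ submatrix 0 1 (μ g) ∷ submatrix 1 0 (μ g) ∷ submatrix 1 1 (μ g) ∷ []

quads-closed : All (λ g → All (_∈ quads) (children g)) quads
quads-closed = toWitness {a? = all? (λ g → all? (_∈? quads) (children g)) quads} _

submatrix-μ-∈-children : ∀ {a b} g → a < 2 → b < 2 → submatrix a b (μ g) ∈ children g
submatrix-μ-∈-children g (s≤s z≤n)       (s≤s z≤n)       = here refl
submatrix-μ-∈-children g (s≤s z≤n)       (s≤s (s≤s z≤n)) = there (here refl)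
submatrix-μ-∈-children g (s≤s (s≤s z≤n)) (s≤s z≤n)       = there (there (here refl))
submatrix-μ-∈-children g (s≤s (s≤s z≤n)) (s≤s (s≤s z≤n)) = there (there (there (here refl)))

window-∈-children : ∀ r c → window {2} {2} r c ∈ children (window ⌊ r /2⌋ ⌊ c /2⌋)
window-∈-children r c with double-⌊/2⌋-+-rem r | double-⌊/2⌋-+-rem c
... | a , a<2 , r≡ | b , b<2 , c≡ =
  subst₂ (λ r′ c′ → window r′ c′ ∈ children parent) r≡ c≡
    (subst (_∈ children parent) (submatrix-μ-window ⌊ r /2⌋ ⌊ c /2⌋ (fits a<2) (fits b<2))
      (submatrix-μ-∈-children parent a<2 b<2))
  where
  parent : Mat 2 2
  parent = window ⌊ r /2⌋ ⌊ c /2⌋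
  fits : ∀ {a} → a < 2 → a + 2 ≤ 4
  fits a<2 = +-monoˡ-≤ 2 (<⇒≤ a<2)

window-∈-quads : ∀ r c → window {2} {2} r c ∈ quads
window-∈-quads r c = go (r + c) (m≤m+n r c) (m≤n+m c r)
  where
  go : ∀ k {r c} → r ≤ k → c ≤ k → window {2} {2} r c ∈ quads
  go zero            z≤n   z≤n   = here refl
  go (suc k) {r} {c} r≤1+k c≤1+k =
    All.lookup (All.lookup quads-closed (go k (⌊/2⌋-≤-pred r≤1+k) (⌊/2⌋-≤-pred c≤1+k))) (window-∈-children r c)

RecursBelow : ℕ → ℕ → Set
RecursBelow m bound = ∀ R Q → ∃₂ λ R′ Q′ → R′ < bound × Q′ < bound × window {m} {m} R Q ≡ window R′ Q′

window-recurs : ∀ k {m} → m ≤ 2 + k → Σ ℕ (RecursBelow m)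
window-recurs zero {m} m≤2 = 24 , quad-recurs
  where
  quad-recurs : RecursBelow m 24
  quad-recurs R Q with ∈-map⁻ (uncurry window) {xs = quadPositions} (window-∈-quads R Q)
  ... | (R′ , Q′) , pos∈ , eq with All.lookup quadPositions-< pos∈
  ... | R′<24 , Q′<24 = R′ , Q′ , R′<24 , Q′<24 , window-≡-prefix R Q R′ Q′ m≤2 m≤2 eq
window-recurs (suc k) {m} m≤3+k
  with window-recurs k {suc ⌊ m /2⌋} (s≤s (≤-trans (⌊n/2⌋-mono m≤3+k) (s≤s (⌊/2⌋-≤-pred ≤-refl))))
... | bound , recurs = double bound , recurs-doubled
  where
  recurs-doubled : RecursBelow m (double bound)
  recurs-doubled R Q with double-⌊/2⌋-+-rem R | double-⌊/2⌋-+-rem Q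
  ... | a , a<2 , R≡ | b , b<2 , Q≡ with recurs ⌊ R /2⌋ ⌊ Q /2⌋
  ... | R₁ , Q₁ , R₁<bound , Q₁<bound , eq =
    double R₁ + a , double Q₁ + b , double+<double a<2 R₁<bound , double+<double b<2 Q₁<bound ,
    subst₂ (λ R Q → window R Q ≡ window (double R₁ + a) (double Q₁ + b)) R≡ Q≡
      (window-≡-μ ⌊ R /2⌋ ⌊ Q /2⌋ R₁ Q₁ a b (+-≤-double-suc-⌊/2⌋ m a<2) (+-≤-double-suc-⌊/2⌋ m b<2) eq)

-- Local recognizability

-- In window-determined, block X of the tiling is μ² of the 2×2 window in row r + X, that is rows
-- 4(r + X) … 4(r + X) + 7 of U.  Its part inside the small window (rows 4r + 3 onwards) starts
-- skip X rows into the block and shift X rows into the small window; likewise for columns.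
skip : ℕ → ℕ
skip zero    = 3
skip (suc _) = 0

shift : ℕ → ℕ
shift zero    = 0
shift (suc X) = 4 * X + 1

skips : List ℕ
skips = 3 ∷ 0 ∷ []

skip∈skips : ∀ X → skip X ∈ skips
skip∈skips zero    = here refl
skip∈skips (suc X) = there (here refl)

Recognizes : ℕ → ℕ → Mat 2 2 → Mat 2 2 → Set
Recognizes a b g g′ =
  submatrix {4} {5} a b (μ (μ g)) ≡ submatrix a b (μ (μ g′)) →
  submatrix {7} {7} 0 1 (μ (μ g)) ≡ submatrix 0 1 (μ (μ g′))

quads-recognizable :
  All (λ g → All (λ g′ → All (λ a → All (λ b → Recognizes a b g g′) skips) skips) quads) quads
quads-recognizable = toWitness
  {a? = all? (λ g → all? (λ g′ → all? (λ a → all? (λ b → recognizes? a b g g′) skips) skips) quads) quads} _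
  where
  recognizes? : ∀ a b g g′ → Dec (Recognizes a b g g′)
  recognizes? a b g g′ =
    (submatrix a b (μ (μ g)) ≟ᴹ submatrix a b (μ (μ g′))) →-dec
    (submatrix 0 1 (μ (μ g)) ≟ᴹ submatrix 0 1 (μ (μ g′)))

window-recognizable : ∀ X Y R Q R′ Q′ →
  window {4} {5} (4 * R + skip X) (4 * Q + skip Y) ≡ window (4 * R′ + skip X) (4 * Q′ + skip Y) →
  window {7} {7} (4 * R + 0) (4 * Q + 1) ≡ window (4 * R′ + 0) (4 * Q′ + 1)
window-recognizable X Y R Q R′ Q′ known≡ = begin
  window (4 * R + 0) (4 * Q + 1)    ≡⟨ submatrix-μ²-window {7} {7} {2} {2} R Q (n≤1+n 7) ≤-refl ⟨
  submatrix 0 1 (μ (μ g))           ≡⟨ recognizes known-μ²≡ ⟩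
  submatrix 0 1 (μ (μ g′))          ≡⟨ submatrix-μ²-window {7} {7} {2} {2} R′ Q′ (n≤1+n 7) ≤-refl ⟩
  window (4 * R′ + 0) (4 * Q′ + 1)  ∎
  where
  open ≡-Reasoning
  g g′ : Mat 2 2
  g  = window R Q
  g′ = window R′ Q′
  recognizes : Recognizes (skip X) (skip Y) g g′
  recognizes = All.lookup (All.lookup (All.lookup (All.lookup quads-recognizable
    (window-∈-quads R Q)) (window-∈-quads R′ Q′)) (skip∈skips X)) (skip∈skips Y)
  rows-fit : ∀ X → skip X + 4 ≤ 8
  rows-fit zero    = n≤1+n 7
  rows-fit (suc X) = m≤m+n 4 4
  cols-fit : ∀ Y → skip Y + 5 ≤ 8
  cols-fit zero    = ≤-refl
  cols-fit (suc Y) = m≤m+n 5 3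
  known-μ²≡ : submatrix {4} {5} (skip X) (skip Y) (μ (μ g)) ≡ submatrix (skip X) (skip Y) (μ (μ g′))
  known-μ²≡ = trans (submatrix-μ²-window {4} {5} {2} {2} R Q (rows-fit X) (cols-fit Y))
                (trans known≡ (sym (submatrix-μ²-window {4} {5} {2} {2} R′ Q′ (rows-fit X) (cols-fit Y))))

shift+skip : ∀ r X → 4 * r + 3 + shift X ≡ 4 * (r + X) + skip X
shift+skip r zero    = arith r
  where
  arith : ∀ r → 4 * r + 3 + 0 ≡ 4 * (r + 0) + 3
  arith = solve-∀
shift+skip r (suc X) = arith r X
  where
  arith : ∀ r X → 4 * r + 3 + (4 * X + 1) ≡ 4 * (r + suc X) + 0
  arith = solve-∀

shift-fits : ∀ {n X} → 1 ≤ n → X ≤ n → ∀ e → shift X + (4 + e) ≤ 4 * n + (1 + e)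
shift-fits {n} {X} 1≤n X≤n e = begin
  shift X + (4 + e)  ≡⟨ +-assoc (shift X) 4 e ⟨
  shift X + 4 + e    ≤⟨ +-monoˡ-≤ e (row-fits X X≤n) ⟩
  4 * n + 1 + e      ≡⟨ +-assoc (4 * n) 1 e ⟩
  4 * n + (1 + e)    ∎
  where
  open ≤-Reasoning
  arith : ∀ X → 4 * X + 1 + 4 ≡ 4 * suc X + 1
  arith = solve-∀
  row-fits : ∀ X → X ≤ n → shift X + 4 ≤ 4 * n + 1
  row-fits zero    _   = ≤-trans (*-monoʳ-≤ 4 1≤n) (m≤m+n (4 * n) 1)
  row-fits (suc X) X<n = ≤-trans (≤-reflexive (arith X)) (+-monoˡ-≤ 1 (*-monoʳ-≤ 4 X<n))

block-split : ∀ n p → p < 4 * n + 7 → ∃₂ λ X a → X ≤ n × a < 7 × p ≡ 4 * X + a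
block-split n p p<4n+7 with p <? 7
... | yes p<7 = 0 , p , z≤n , p<7 , refl
block-split zero    p p<7     | no p≮7 = contradiction p<7 p≮7
block-split (suc n) p p<4n+11 | no p≮7 = peel (≤-trans (m≤m+n 4 3) (≮⇒≥ p≮7))
  where
  arith₁ : ∀ n → 4 * suc n + 7 ≡ 4 + (4 * n + 7)
  arith₁ = solve-∀
  arith₂ : ∀ X a → 4 + (4 * X + a) ≡ 4 * suc X + a
  arith₂ = solve-∀
  peel : 4 ≤ p → ∃₂ λ X a → X ≤ suc n × a < 7 × p ≡ 4 * X + a
  peel 4≤p with block-split n (p ∸ 4)
    (+-cancelˡ-< 4 (p ∸ 4) (4 * n + 7) (subst₂ _<_ (sym (m+[n∸m]≡n 4≤p)) (arith₁ n) p<4n+11))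
  ... | X , a , X≤n , a<7 , p∸4≡ = suc X , a , s≤s X≤n , a<7 , (begin
    p                ≡⟨ m+[n∸m]≡n 4≤p ⟨
    4 + (p ∸ 4)      ≡⟨ cong (4 +_) p∸4≡ ⟩
    4 + (4 * X + a)  ≡⟨ arith₂ X a ⟩
    4 * suc X + a    ∎)
    where open ≡-Reasoning

window-determined : ∀ {n} r c r′ c′ → 1 ≤ n →
  window {4 * n + 1} {4 * n + 2} (4 * r + 3) (4 * c + 3) ≡ window (4 * r′ + 3) (4 * c′ + 3) →
  window {4 * n + 7} {4 * n + 7} (4 * r + 0) (4 * c + 1) ≡ window (4 * r′ + 0) (4 * c′ + 1)
window-determined {n} r c r′ c′ 1≤n small≡ =
  U≡⇒window-≡ (4 * r + 0) (4 * c + 1) (4 * r′ + 0) (4 * c′ + 1) λ p q p< q< →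
    entry (block-split n p p<) (block-split n q q<)
  where
  open ≡-Reasoning
  block≡ : ∀ {X Y} → X ≤ n → Y ≤ n →
    window {7} {7} (4 * (r + X) + 0) (4 * (c + Y) + 1) ≡ window (4 * (r′ + X) + 0) (4 * (c′ + Y) + 1)
  block≡ {X} {Y} X≤n Y≤n = window-recognizable X Y (r + X) (c + Y) (r′ + X) (c′ + Y) (begin
    window (4 * (r + X) + skip X) (4 * (c + Y) + skip Y)
      ≡⟨ cong₂ window (shift+skip r X) (shift+skip c Y) ⟨
    window (4 * r + 3 + shift X) (4 * c + 3 + shift Y)
      ≡⟨ window-≡-sub (4 * r + 3) (4 * c + 3) (4 * r′ + 3) (4 * c′ + 3) (shift X) (shift Y)
           (shift-fits 1≤n X≤n 0) (shift-fits 1≤n Y≤n 1) small≡ ⟩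
    window (4 * r′ + 3 + shift X) (4 * c′ + 3 + shift Y)
      ≡⟨ cong₂ window (shift+skip r′ X) (shift+skip c′ Y) ⟩
    window (4 * (r′ + X) + skip X) (4 * (c′ + Y) + skip Y)
      ∎)
  regroup : ∀ r X s a → 4 * r + s + (4 * X + a) ≡ 4 * (r + X) + s + a
  regroup = solve-∀
  entry : ∀ {p q} → (∃₂ λ X a → X ≤ n × a < 7 × p ≡ 4 * X + a) →
    (∃₂ λ Y b → Y ≤ n × b < 7 × q ≡ 4 * Y + b) →
    U (4 * r + 0 + p) (4 * c + 1 + q) ≡ U (4 * r′ + 0 + p) (4 * c′ + 1 + q)
  entry (X , a , X≤n , a<7 , refl) (Y , b , Y≤n , b<7 , refl) = begin
    U (4 * r + 0 + (4 * X + a)) (4 * c + 1 + (4 * Y + b))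
      ≡⟨ cong₂ U (regroup r X 0 a) (regroup c Y 1 b) ⟩
    U (4 * (r + X) + 0 + a) (4 * (c + Y) + 1 + b)
      ≡⟨ window-≡⇒U≡ (4 * (r + X) + 0) (4 * (c + Y) + 1) (4 * (r′ + X) + 0) (4 * (c′ + Y) + 1)
           (block≡ X≤n Y≤n) a<7 b<7 ⟩
    U (4 * (r′ + X) + 0 + a) (4 * (c′ + Y) + 1 + b)
      ≡⟨ cong₂ U (regroup r′ X 0 a) (regroup c′ Y 1 b) ⟨
    U (4 * r′ + 0 + (4 * X + a)) (4 * c′ + 1 + (4 * Y + b))
      ∎

Unique-map⁺ : ∀ {X Y : Set} {f : X → Y} {xs} → (∀ {x y} → x ∈ xs → y ∈ xs → f x ≡ f y → x ≡ y) →
  Unique xs → Unique (map f xs)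
Unique-map⁺ inj []         = []
Unique-map⁺ inj (x∉xs ∷ u) =
  All.map⁺ (All.tabulate λ y∈xs fx≡fy → All.lookup x∉xs y∈xs (inj (here refl) (there y∈xs) fx≡fy))
  ∷ Unique-map⁺ (λ x∈ y∈ → inj (there x∈) (there y∈)) u

HasCard-dedup : ∀ {I Y : Set} {S : Y → Set} (_≟_ : DecidableEquality Y) (f : I → Y) (l : List I) →
  (∀ y → S y ⇔ ∃ λ i → i ∈ l × y ≡ f i) → HasCard S (length (deduplicate _≟_ (map f l)))
HasCard-dedup _≟_ f l S⇔ =
  deduplicate _≟_ (map f l) , deduplicate-! _≟_ (map f l) ,
  (λ y → ⇔.trans (⇔.sym (deduplicate-∈⇔ _≟_)) (⇔.trans (⇔.sym (↔⇒⇔ (map-∈↔ f))) (⇔.sym (S⇔ y)))) ,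
  refl

HasCard-image : ∀ {X Y : Set} {S : X → Set} {S′ : Y → Set} {c} (f : X → Y) → HasCard S c →
  (∀ y → S′ y ⇔ ∃ λ x → S x × y ≡ f x) → (∀ {x x′} → S x → S x′ → f x ≡ f x′ → x ≡ x′) →
  HasCard S′ c
HasCard-image {S = S} f (l , unique , ∈l⇔S , length≡c) S′⇔ injective =
  map f l , Unique-map⁺ (λ x∈ x′∈ → injective (to (∈l⇔S _) x∈) (to (∈l⇔S _) x′∈)) unique ,
  (λ y → ⇔.trans (⇔.sym (↔⇒⇔ (map-∈↔ f))) (⇔.trans ∃-∈l⇔∃-S (⇔.sym (S′⇔ y)))) ,
  trans (length-map f l) length≡c
  where
  ∃-∈l⇔∃-S : ∀ {y} → (∃ λ x → x ∈ l × y ≡ f x) ⇔ (∃ λ x → S x × y ≡ f x)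
  ∃-∈l⇔∃-S = mk⇔ (λ (x , x∈ , eq) → x , to (∈l⇔S x) x∈ , eq)
                 (λ (x , Sx , eq) → x , from (∈l⇔S x) Sx , eq)

Q₁₂ : (n : ℕ) → Mat (4 * n + 7) (4 * n + 7) → Set
Q₁₂ n = InQ 1 2 (4 * n + 7) (4 * n + 7)

Q₄₄ : (n : ℕ) → Mat (4 * n + 1) (4 * n + 2) → Set
Q₄₄ n = InQ 4 4 (4 * n + 1) (4 * n + 2)

offset+m≤4*m : ∀ {a m} → a ≤ 3 → 1 ≤ m → a + m ≤ 4 * m
offset+m≤4*m {a} {m} a≤3 1≤m = begin
  a + m      ≤⟨ +-monoˡ-≤ m (≤-trans a≤3 (*-monoʳ-≤ 3 1≤m)) ⟩
  3 * m + m  ≡⟨ +-comm (3 * m) m ⟩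
  4 * m      ∎
  where open ≤-Reasoning

1≤+suc : ∀ x y → 1 ≤ x + suc y
1≤+suc x y = ≤-trans (s≤s z≤n) (m≤n+m (suc y) x)

Q₁₂-window : ∀ n R Q → Q₁₂ n (window (4 * R + 0) (4 * Q + 1))
Q₁₂-window n R Q = window-InQ 1 2 R Q (offset+m≤4*m z≤n (1≤+suc _ 6)) (offset+m≤4*m (s≤s z≤n) (1≤+suc _ 6))

Q₁₂-finite : ∀ n → Σ ℕ (HasCard (Q₁₂ n))
Q₁₂-finite n with window-recurs n {2 + n} ≤-refl
... | bound , recurs =
  _ , HasCard-dedup _≟ᴹ_ big positions λ y → mk⇔ enumerate λ { ((R , Q) , _ , refl) → Q₁₂-window n R Q }
  where
  positions : List (ℕ × ℕ)
  positions = cartesianProduct (upTo bound) (upTo bound)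
  big : ℕ × ℕ → Mat (4 * n + 7) (4 * n + 7)
  big (R , Q) = window (4 * R + 0) (4 * Q + 1)
  arith : ∀ n → 1 + (4 * n + 7) ≡ 4 * (2 + n)
  arith = solve-∀
  fits : 1 + (4 * n + 7) ≤ 4 * (2 + n)
  fits = ≤-reflexive (arith n)
  enumerate : ∀ {y} → Q₁₂ n y → ∃ λ pos → pos ∈ positions × y ≡ big pos
  enumerate {y} y∈Q with InQ⇒window 1 2 y y∈Q
  ... | R , Q , refl with recurs R Q
  ... | R′ , Q′ , R′<bound , Q′<bound , eq =
    (R′ , Q′) , ∈-cartesianProduct⁺ (∈-upTo⁺ R′<bound) (∈-upTo⁺ Q′<bound) ,
    window-≡-μ² R Q R′ Q′ 0 1 (≤-trans (n≤1+n _) fits) fits eq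

submatrix-big : ∀ n R Q →
  submatrix 3 2 (window {4 * n + 7} {4 * n + 7} (4 * R + 0) (4 * Q + 1)) ≡
  window {4 * n + 1} {4 * n + 2} (4 * R + 3) (4 * Q + 3)
submatrix-big n R Q =
  trans (submatrix-window (4 * R + 0) (4 * Q + 1) (fits (arith₁ n)) (fits (arith₂ n)))
        (cong₂ window (+-assoc (4 * R) 0 3) (+-assoc (4 * Q) 1 2))
  where
  arith₁ : ∀ n → 3 + (4 * n + 1) ≡ 4 * n + 4
  arith₁ = solve-∀
  arith₂ : ∀ n → 2 + (4 * n + 2) ≡ 4 * n + 4
  arith₂ = solve-∀
  fits : ∀ {x} → x ≡ 4 * n + 4 → x ≤ 4 * n + 7
  fits refl = +-monoʳ-≤ (4 * n) (m≤m+n 4 3)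

Q₄₄⇔submatrix-Q₁₂ : ∀ n y → Q₄₄ n y ⇔ ∃ λ x → Q₁₂ n x × y ≡ submatrix 3 2 x
Q₄₄⇔submatrix-Q₁₂ n y = mk⇔ cut uncut
  where
  cut : Q₄₄ n y → ∃ λ x → Q₁₂ n x × y ≡ submatrix 3 2 x
  cut y∈Q with InQ⇒window 4 4 y y∈Q
  ... | R , Q , refl = window (4 * R + 0) (4 * Q + 1) , Q₁₂-window n R Q , sym (submatrix-big n R Q)
  uncut : (∃ λ x → Q₁₂ n x × y ≡ submatrix 3 2 x) → Q₄₄ n y
  uncut (x , x∈Q , refl) with InQ⇒window 1 2 x x∈Q
  ... | R , Q , refl = subst (Q₄₄ n) (sym (submatrix-big n R Q))
    (window-InQ 4 4 R Q (offset+m≤4*m ≤-refl (1≤+suc _ 0)) (offset+m≤4*m ≤-refl (1≤+suc _ 1)))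

submatrix-injective-on-Q₁₂ : ∀ {n x x′} → 1 ≤ n → Q₁₂ n x → Q₁₂ n x′ →
  submatrix {4 * n + 1} {4 * n + 2} 3 2 x ≡ submatrix 3 2 x′ → x ≡ x′
submatrix-injective-on-Q₁₂ {n} {x} {x′} 1≤n x∈Q x′∈Q eq
  with InQ⇒window 1 2 x x∈Q | InQ⇒window 1 2 x′ x′∈Q
... | R , Q , refl | R′ , Q′ , refl =
  window-determined R Q R′ Q′ 1≤n (trans (sym (submatrix-big n R Q)) (trans eq (submatrix-big n R′ Q′)))

lemma8 : (n : ℕ) → 1 ≤ n →
    Σ ℕ λ c → HasCard (InQ 4 4 (4 * n + 1) (4 * n + 2)) c
            × HasCard (InQ 1 2 (4 * n + 7) (4 * n + 7)) c
lemma8 n 1≤n =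
  let c , Q₁₂-card = Q₁₂-finite n in
  c , HasCard-image (submatrix 3 2) Q₁₂-card (Q₄₄⇔submatrix-Q₁₂ n) (submatrix-injective-on-Q₁₂ 1≤n) ,
      Q₁₂-card
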